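{- For every integer $k\ge 1$ and every integer $s\in\{1,\dots,2^k-1\}$, there exists a binary linear code of dimension $k$ (over $\mathbb{F}_2$) whose codewords have exactly $s$ distinct non-zero Hamming weights.
   Context: The Hamming weight of a vector is its number of non-zero coordinates. -}

module Defs where

open import Data.Bool using (Bool; true; false; _xor_; _∧_)
open import Data.Nat using (ℕ; zero; suc; _+_; _^_; _≤_; _∸_)
open import Data.Vec using (Vec; []; _∷_; replicate; zipWith; foldr; count)
open import Data.List using (List; length)
open import Data.List.Membership.Propositional using (_∈_)
open import Data.List.Relation.Unary.Unique.Propositional using (Unique)
open import Data.Product using (Σ; ∃; _×_; _,_)
open import Relation.Binary.PropositionalEquality using (_≡_; _≢_)
open import Function.Bundles using (_⇔_)
open import Relation.Nullary using (¬_)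
open import Data.Bool using (T)
open import Relation.Nullary.Decidable.Core using (T?)

-- The field F₂ is modelled by Bool: addition = xor, multiplication = ∧.
-- Vectors of F₂ⁿ are Vec Bool n.

zeroVec : (n : ℕ) → Vec Bool n
zeroVec n = replicate n false

_⊕_ : {n : ℕ} → Vec Bool n → Vec Bool n → Vec Bool n
_⊕_ = zipWith _xor_

_·_ : {n : ℕ} → Bool → Vec Bool n → Vec Bool n
a · v = Data.Vec.map (a ∧_) v

combination : {k n : ℕ} → Vec Bool k → Vec (Vec Bool n) k → Vec Bool n
combination {n = n} [] [] = zeroVec n
combination (u ∷ us) (g ∷ gs) = (u · g) ⊕ combination us gs

weight : {n : ℕ} → Vec Bool n → ℕ
weight v = count T? v

-- A generator matrix of a binary linear code of length n and dimension k:
-- k rows that are linearly independent over F₂ (the code is their span,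
-- which then has dimension exactly k).
LinearlyIndependent : {k n : ℕ} → Vec (Vec Bool n) k → Set
LinearlyIndependent {k} {n} G =
  (u : Vec Bool k) → combination u G ≡ zeroVec n → u ≡ zeroVec k

IsCodeword : {k n : ℕ} → Vec (Vec Bool n) k → Vec Bool n → Set
IsCodeword {k} G c = ∃ λ (u : Vec Bool k) → combination u G ≡ c

IsNonzeroWeight : {k n : ℕ} → Vec (Vec Bool n) k → ℕ → Set
IsNonzeroWeight {n = n} G w =
  ∃ λ c → IsCodeword G c × c ≢ zeroVec n × weight c ≡ w

HasExactlyWeights : {k n : ℕ} → Vec (Vec Bool n) k → ℕ → Set
HasExactlyWeights G s =
  Σ (List ℕ) λ ws → Unique ws × length ws ≡ s ×
    ((w : ℕ) → (w ∈ ws) ⇔ IsNonzeroWeight G w)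

-- Let G = [T | D(a)], where the columns of T are all 2ᵏ vectors of F₂ᵏ and
-- D(a) is block diagonal with an all-ones block of length aᵢ in row i. Every
-- non-zero codeword of T has weight 2ᵏ⁻¹, so the codeword uG has weight
-- 2ᵏ⁻¹ + Σ_{uᵢ = 1} aᵢ, and T alone makes the rows independent. It therefore
-- suffices to find a ∈ ℕᵏ whose non-empty subset sums are exactly s
-- consecutive numbers. Such an a is built greedily: if the non-empty subset
-- sums of a are [c, c + s) with c ≤ 1, prepending t with c ≤ t ≤ c + s
-- turns them into [c, c + t + s). Starting from c = 0 this reaches every
-- s ≤ 2ᵏ⁻¹, starting from c = 1 every s with k ≤ s ≤ 2ᵏ − 1.
module Submission where

open import Defs
open import Data.Nat using (ℕ; _≤_; _^_; _∸_)
open import Data.Bool using (Bool)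
open import Data.Vec using (Vec)
open import Data.Product using (Σ; _×_)

import Algebra.Properties.CommutativeSemigroup as CommutativeSemigroupProperties
open import Data.Bool using (true; false; _xor_; if_then_else_) renaming (_≟_ to _≟ᴮ_)
open import Data.Empty using (⊥-elim)
open import Data.List using (upTo) renaming (map to mapᴸ)
open import Data.List.Membership.Propositional using (_∈_)
open import Data.List.Membership.Propositional.Properties using (∈-map⁺; ∈-map⁻; ∈-upTo⁺; ∈-upTo⁻)
open import Data.List.Properties using (length-map; length-upTo)
open import Data.List.Relation.Unary.Unique.Propositional.Properties using (map⁺; upTo⁺)
open import Data.Nat using (zero; suc; _+_; _<_; z≤n; s≤s; _≤?_; _<?_)
open import Data.Nat.Properties
open import Data.Product using (∃; _,_; proj₁; proj₂; map₂)
open import Data.Vec using ([]; _∷_; _++_; replicate; sum; zipWith)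
open import Data.Vec.Properties using (≡-dec; ++-injectiveˡ; ∷-injectiveʳ; map-++; zipWith-++)
open import Function using (_∘_)
open import Function.Bundles using (mk⇔)
open import Relation.Nullary using (Dec; yes; no)
open import Relation.Binary.PropositionalEquality

open CommutativeSemigroupProperties +-commutativeSemigroup using (x∙yz≈y∙xz)

private
  variable
    k m n : ℕ

ones : (n : ℕ) → Vec Bool n
ones n = replicate n true

⊕-identityˡ : (v : Vec Bool n) → zeroVec n ⊕ v ≡ v
⊕-identityˡ [] = refl
⊕-identityˡ (x ∷ v) = cong (x ∷_) (⊕-identityˡ v)

⊕-identityʳ : (v : Vec Bool n) → v ⊕ zeroVec n ≡ v
⊕-identityʳ [] = refl
⊕-identityʳ (false ∷ v) = cong (false ∷_) (⊕-identityʳ v)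
⊕-identityʳ (true ∷ v) = cong (true ∷_) (⊕-identityʳ v)

·-identityˡ : (v : Vec Bool n) → true · v ≡ v
·-identityˡ [] = refl
·-identityˡ (x ∷ v) = cong (x ∷_) (·-identityˡ v)

·-zeroˡ : (v : Vec Bool n) → false · v ≡ zeroVec n
·-zeroˡ [] = refl
·-zeroˡ (x ∷ v) = cong (false ∷_) (·-zeroˡ v)

·-zeroʳ : (b : Bool) → b · zeroVec n ≡ zeroVec n
·-zeroʳ false = ·-zeroˡ (zeroVec _)
·-zeroʳ true = ·-identityˡ (zeroVec _)

zeroVec-+ : ∀ m n → zeroVec (m + n) ≡ zeroVec m ++ zeroVec n
zeroVec-+ zero n = refl
zeroVec-+ (suc m) n = cong (false ∷_) (zeroVec-+ m n)

weight-++ : (x : Vec Bool m) (y : Vec Bool n) → weight (x ++ y) ≡ weight x + weight y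
weight-++ [] y = refl
weight-++ (false ∷ x) y = weight-++ x y
weight-++ (true ∷ x) y = cong suc (weight-++ x y)

weight-zeroVec : ∀ n → weight (zeroVec n) ≡ 0
weight-zeroVec zero = refl
weight-zeroVec (suc n) = weight-zeroVec n

weight-ones : ∀ n → weight (ones n) ≡ n
weight-ones zero = refl
weight-ones (suc n) = cong suc (weight-ones n)

weight-complement : (v : Vec Bool n) → weight v + weight (ones n ⊕ v) ≡ n
weight-complement [] = refl
weight-complement (false ∷ v) = trans (+-suc _ _) (cong suc (weight-complement v))
weight-complement (true ∷ v) = cong suc (weight-complement v)

weight-·-ones : ∀ b n → weight (b · ones n) ≡ (if b then n else 0)
weight-·-ones true n = trans (cong weight (·-identityˡ (ones n))) (weight-ones n)
weight-·-ones false n = trans (cong weight (·-zeroˡ (ones n))) (weight-zeroVec n)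

combination-zeroVec : (G : Vec (Vec Bool n) k) → combination (zeroVec k) G ≡ zeroVec n
combination-zeroVec [] = refl
combination-zeroVec (g ∷ G) = trans (cong₂ _⊕_ (·-zeroˡ g) (combination-zeroVec G)) (⊕-identityˡ _)

combination-zeroRows : (u : Vec Bool k) → combination u (replicate k (zeroVec n)) ≡ zeroVec n
combination-zeroRows [] = refl
combination-zeroRows (b ∷ u) = trans (cong₂ _⊕_ (·-zeroʳ b) (combination-zeroRows u)) (⊕-identityˡ _)

combination-zipWith-++ : (u : Vec Bool k) (A : Vec (Vec Bool m) k) (B : Vec (Vec Bool n) k) →
  combination u (zipWith _++_ A B) ≡ combination u A ++ combination u B
combination-zipWith-++ {m = m} {n} [] [] [] = zeroVec-+ m n
combination-zipWith-++ (b ∷ u) (g ∷ A) (h ∷ B) = begin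
  (b · (g ++ h)) ⊕ combination u (zipWith _++_ A B)
    ≡⟨ cong₂ _⊕_ (map-++ _ g h) (combination-zipWith-++ u A B) ⟩
  ((b · g) ++ (b · h)) ⊕ (combination u A ++ combination u B)
    ≡⟨ zipWith-++ _xor_ (b · g) (b · h) _ _ ⟩
  ((b · g) ⊕ combination u A) ++ ((b · h) ⊕ combination u B) ∎
  where open ≡-Reasoning

zipWith-++-linearlyIndependent : (A : Vec (Vec Bool m) k) (B : Vec (Vec Bool n) k) →
  LinearlyIndependent A → LinearlyIndependent (zipWith _++_ A B)
zipWith-++-linearlyIndependent {m} {n = n} A B independent u uAB≡0 = independent u (++-injectiveˡ _ _ (begin
  combination u A ++ combination u B ≡⟨ combination-zipWith-++ u A B ⟨
  combination u (zipWith _++_ A B)   ≡⟨ uAB≡0 ⟩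
  zeroVec (m + n)                    ≡⟨ zeroVec-+ m n ⟩
  zeroVec m ++ zeroVec n             ∎))
  where open ≡-Reasoning

pow₂ : ℕ → ℕ
pow₂ zero = 1
pow₂ (suc k) = pow₂ k + pow₂ k

-- Columns: all of F₂ᵏ, those with first entry 0 followed by those with first entry 1.
allColumns : (k : ℕ) → Vec (Vec Bool (pow₂ k)) k
allColumns zero = []
allColumns (suc k) = (zeroVec (pow₂ k) ++ ones (pow₂ k)) ∷ zipWith _++_ (allColumns k) (allColumns k)

combination-allColumns-∷ : ∀ b (u : Vec Bool k) → let v = combination u (allColumns k) in
  combination (b ∷ u) (allColumns (suc k)) ≡ v ++ ((b · ones (pow₂ k)) ⊕ v)
combination-allColumns-∷ {k} b u = begin
  (b · (0ₖ ++ 1ₖ)) ⊕ combination u (zipWith _++_ (allColumns k) (allColumns k))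
    ≡⟨ cong₂ _⊕_ (map-++ _ 0ₖ 1ₖ) (combination-zipWith-++ u (allColumns k) (allColumns k)) ⟩
  ((b · 0ₖ) ++ (b · 1ₖ)) ⊕ (v ++ v)
    ≡⟨ zipWith-++ _xor_ (b · 0ₖ) (b · 1ₖ) v v ⟩
  ((b · 0ₖ) ⊕ v) ++ ((b · 1ₖ) ⊕ v)
    ≡⟨ cong (λ z → (z ⊕ v) ++ ((b · 1ₖ) ⊕ v)) (·-zeroʳ b) ⟩
  (0ₖ ⊕ v) ++ ((b · 1ₖ) ⊕ v)
    ≡⟨ cong (_++ ((b · 1ₖ) ⊕ v)) (⊕-identityˡ v) ⟩
  v ++ ((b · 1ₖ) ⊕ v) ∎
  where
  open ≡-Reasoning
  0ₖ = zeroVec (pow₂ k)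
  1ₖ = ones (pow₂ k)
  v = combination u (allColumns k)

weight-allColumns : ∀ k (u : Vec Bool (suc k)) → u ≢ zeroVec (suc k) →
  weight (combination u (allColumns (suc k))) ≡ pow₂ k
weight-allColumns k (true ∷ u) _ = begin
  weight (combination (true ∷ u) (allColumns (suc k)))
    ≡⟨ cong weight (combination-allColumns-∷ true u) ⟩
  weight (v ++ ((true · ones _) ⊕ v))
    ≡⟨ weight-++ v _ ⟩
  weight v + weight ((true · ones _) ⊕ v)
    ≡⟨ cong (λ z → weight v + weight (z ⊕ v)) (·-identityˡ (ones _)) ⟩
  weight v + weight (ones _ ⊕ v)
    ≡⟨ weight-complement v ⟩
  pow₂ k ∎
  where
  open ≡-Reasoning
  v = combination u (allColumns k)
weight-allColumns zero (false ∷ []) u≢0 = ⊥-elim (u≢0 refl)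
weight-allColumns (suc k) (false ∷ u) u≢0 = begin
  weight (combination (false ∷ u) (allColumns (suc (suc k))))
    ≡⟨ cong weight (combination-allColumns-∷ false u) ⟩
  weight (v ++ ((false · ones _) ⊕ v))
    ≡⟨ weight-++ v _ ⟩
  weight v + weight ((false · ones _) ⊕ v)
    ≡⟨ cong (λ z → weight v + weight (z ⊕ v)) (·-zeroˡ (ones _)) ⟩
  weight v + weight (zeroVec _ ⊕ v)
    ≡⟨ cong (λ z → weight v + weight z) (⊕-identityˡ v) ⟩
  weight v + weight v
    ≡⟨ cong₂ _+_ weight-v weight-v ⟩
  pow₂ (suc k) ∎
  where
  open ≡-Reasoning
  v = combination u (allColumns (suc k))
  weight-v = weight-allColumns k u (u≢0 ∘ cong (false ∷_))

pow₂-positive : ∀ k → 0 < pow₂ k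
pow₂-positive zero = s≤s z≤n
pow₂-positive (suc k) = ≤-trans (pow₂-positive k) (m≤m+n _ _)

allColumns-linearlyIndependent : ∀ k → LinearlyIndependent (allColumns (suc k))
allColumns-linearlyIndependent k u uG≡0 with ≡-dec _≟ᴮ_ u (zeroVec (suc k))
... | yes u≡0 = u≡0
... | no u≢0 = ⊥-elim (<⇒≢ (pow₂-positive k) (begin
  0                                           ≡⟨ weight-zeroVec (pow₂ (suc k)) ⟨
  weight (zeroVec (pow₂ (suc k)))             ≡⟨ cong weight uG≡0 ⟨
  weight (combination u (allColumns (suc k))) ≡⟨ weight-allColumns k u u≢0 ⟩
  pow₂ k                                      ∎))
  where open ≡-Reasoning

subsetSum : Vec ℕ k → Vec Bool k → ℕ
subsetSum [] [] = 0
subsetSum (t ∷ a) (b ∷ u) = (if b then t else 0) + subsetSum a u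

subsetSum-zeroVec : (a : Vec ℕ k) → subsetSum a (zeroVec k) ≡ 0
subsetSum-zeroVec [] = refl
subsetSum-zeroVec (t ∷ a) = subsetSum-zeroVec a

blockDiagonal : (a : Vec ℕ k) → Vec (Vec Bool (sum a)) k
blockDiagonal [] = []
blockDiagonal {suc k} (t ∷ a) =
  (ones t ++ zeroVec (sum a)) ∷ zipWith _++_ (replicate k (zeroVec t)) (blockDiagonal a)

weight-blockDiagonal : (a : Vec ℕ k) (u : Vec Bool k) →
  weight (combination u (blockDiagonal a)) ≡ subsetSum a u
weight-blockDiagonal [] [] = refl
weight-blockDiagonal {suc k} (t ∷ a) (b ∷ u) = begin
  weight ((b · (ones t ++ zeroVec _)) ⊕ combination u (zipWith _++_ (replicate k (zeroVec t)) (blockDiagonal a)))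
    ≡⟨ cong weight (cong₂ _⊕_ (map-++ _ (ones t) (zeroVec _)) (combination-zipWith-++ u _ _)) ⟩
  weight (((b · ones t) ++ (b · zeroVec _)) ⊕ (combination u (replicate k (zeroVec t)) ++ v))
    ≡⟨ cong weight (cong₂ (λ x y → ((b · ones t) ++ x) ⊕ (y ++ v)) (·-zeroʳ b) (combination-zeroRows u)) ⟩
  weight (((b · ones t) ++ zeroVec _) ⊕ (zeroVec t ++ v))
    ≡⟨ cong weight (zipWith-++ _xor_ (b · ones t) (zeroVec _) (zeroVec t) v) ⟩
  weight (((b · ones t) ⊕ zeroVec t) ++ (zeroVec _ ⊕ v))
    ≡⟨ cong weight (cong₂ _++_ (⊕-identityʳ (b · ones t)) (⊕-identityˡ v)) ⟩
  weight ((b · ones t) ++ v)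
    ≡⟨ weight-++ (b · ones t) v ⟩
  weight (b · ones t) + weight v
    ≡⟨ cong₂ _+_ (weight-·-ones b t) (weight-blockDiagonal a u) ⟩
  (if b then t else 0) + subsetSum a u ∎
  where
  open ≡-Reasoning
  v = combination u (blockDiagonal a)

SubsetSumsInterval : (c s : ℕ) → Vec ℕ k → Set
SubsetSumsInterval {k} c s a =
  ((u : Vec Bool k) → u ≢ zeroVec k → c ≤ subsetSum a u × subsetSum a u < c + s) ×
  ((j : ℕ) → j < s → ∃ λ (u : Vec Bool k) → u ≢ zeroVec k × subsetSum a u ≡ c + j)

subsetSumsInterval-[_] : ∀ c → SubsetSumsInterval c 1 (c ∷ [])
subsetSumsInterval-[ c ] = bounds , covers
  where
  bounds : (u : Vec Bool 1) → u ≢ zeroVec 1 → c ≤ subsetSum (c ∷ []) u × subsetSum (c ∷ []) u < c + 1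
  bounds (false ∷ []) u≢0 = ⊥-elim (u≢0 refl)
  bounds (true ∷ []) _ = m≤m+n c 0 , +-monoʳ-< c (s≤s z≤n)
  covers : (j : ℕ) → j < 1 → ∃ λ (u : Vec Bool 1) → u ≢ zeroVec 1 × subsetSum (c ∷ []) u ≡ c + j
  covers zero _ = true ∷ [] , (λ ()) , refl
  covers (suc j) (s≤s ())

subsetSumsInterval-nonempty : ∀ {c s} (a : Vec ℕ (suc k)) → SubsetSumsInterval c s a → 0 < s
subsetSumsInterval-nonempty {k} {c} a (bounds , _) with bounds (true ∷ zeroVec k) (λ ())
... | c≤σ , σ<c+s = +-cancelˡ-< c 0 _ (≤-<-trans (≤-reflexive (+-identityʳ c)) (≤-<-trans c≤σ σ<c+s))

-- Values c + j with s ≤ j < t lie above the old sums and below t + c, so only the new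
-- sum t can hit them; c ≤ 1 means there is at most one such value.
gap-≤1 : ∀ {c s j t} → c ≤ 1 → s ≤ j → j < t → t ≤ c + s → t ≡ c + j
gap-≤1 {zero} _ s≤j j<t t≤s = ⊥-elim (<-irrefl refl (<-≤-trans j<t (≤-trans t≤s s≤j)))
gap-≤1 {suc zero} _ s≤j j<t t≤1+s = ≤-antisym (≤-trans t≤1+s (s≤s s≤j)) j<t
gap-≤1 {suc (suc c)} (s≤s ())

∷-subsetSumsInterval : ∀ {c s t} {a : Vec ℕ (suc k)} → c ≤ 1 → c ≤ t → t ≤ c + s →
  SubsetSumsInterval c s a → SubsetSumsInterval c (t + s) (t ∷ a)
∷-subsetSumsInterval {k} {c} {s} {t} {a} c≤1 c≤t t≤c+s I@(bounds , covers) = bounds′ , covers′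
  where
  bounds′ : (u : Vec Bool (suc (suc k))) → u ≢ zeroVec (suc (suc k)) →
    c ≤ subsetSum (t ∷ a) u × subsetSum (t ∷ a) u < c + (t + s)
  bounds′ (false ∷ u) u≢0 =
    map₂ (λ σ<c+s → <-≤-trans σ<c+s (+-monoʳ-≤ c (m≤n+m s t))) (bounds u (u≢0 ∘ cong (false ∷_)))
  bounds′ (true ∷ u) _ with ≡-dec _≟ᴮ_ u (zeroVec (suc k))
  ... | yes refl rewrite subsetSum-zeroVec a | +-identityʳ t =
    c≤t , <-≤-trans (m<m+n t (subsetSumsInterval-nonempty a I)) (m≤n+m (t + s) c)
  ... | no u≢0 with bounds u u≢0
  ... | c≤σ , σ<c+s =
    ≤-trans c≤σ (m≤n+m _ t) , subst (t + subsetSum a u <_) (x∙yz≈y∙xz t c s) (+-monoʳ-< t σ<c+s)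
  covers′ : (j : ℕ) → j < t + s →
    ∃ λ (u : Vec Bool (suc (suc k))) → u ≢ zeroVec (suc (suc k)) × subsetSum (t ∷ a) u ≡ c + j
  covers′ j j<t+s with j <? s
  ... | yes j<s with covers j j<s
  ...   | u , u≢0 , σ≡c+j = false ∷ u , u≢0 ∘ ∷-injectiveʳ , σ≡c+j
  covers′ j j<t+s | no j≮s with t ≤? j
  ... | yes t≤j with covers (j ∸ t) (subst (j ∸ t <_) (m+n∸m≡n t s) (∸-monoˡ-< j<t+s t≤j))
  ...   | u , u≢0 , σ≡c+j∸t = true ∷ u , (λ ()) , (begin
    t + subsetSum a u  ≡⟨ cong (t +_) σ≡c+j∸t ⟩
    t + (c + (j ∸ t))  ≡⟨ x∙yz≈y∙xz t c (j ∸ t) ⟩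
    c + (t + (j ∸ t))  ≡⟨ cong (c +_) (m+[n∸m]≡n t≤j) ⟩
    c + j              ∎)
    where open ≡-Reasoning
  covers′ j j<t+s | no j≮s | no t≰j = true ∷ zeroVec (suc k) , (λ ()) ,
    trans (cong (t +_) (subsetSum-zeroVec a))
      (trans (+-identityʳ t) (gap-≤1 c≤1 (≮⇒≥ j≮s) (≰⇒> t≰j) t≤c+s))

-- The greedy steps from offset c reach every s between these bounds with vectors of length k + 1.
minIntervalLength maxIntervalLength : ℕ → ℕ → ℕ
minIntervalLength c zero = 1
minIntervalLength c (suc k) = minIntervalLength c k + c
maxIntervalLength c zero = 1
maxIntervalLength c (suc k) = maxIntervalLength c k + (c + maxIntervalLength c k)

minIntervalLength≤maxIntervalLength : ∀ c k → minIntervalLength c k ≤ maxIntervalLength c k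
minIntervalLength≤maxIntervalLength c zero = ≤-refl
minIntervalLength≤maxIntervalLength c (suc k) =
  +-mono-≤ (minIntervalLength≤maxIntervalLength c k) (m≤m+n c (maxIntervalLength c k))

subsetSumsInterval-exists : ∀ {c} k {s} → c ≤ 1 →
  minIntervalLength c k ≤ s → s ≤ maxIntervalLength c k → Σ (Vec ℕ (suc k)) (SubsetSumsInterval c s)
subsetSumsInterval-exists {c} zero c≤1 1≤s s≤1
  rewrite ≤-antisym s≤1 1≤s = c ∷ [] , subsetSumsInterval-[ c ]
subsetSumsInterval-exists {c} (suc k) {s} c≤1 lo≤s s≤hi = split (s ≤? c + M)
  where
  M = maxIntervalLength c k
  Result = Σ (Vec ℕ (suc (suc k))) (SubsetSumsInterval c s)
  prepend : ∀ {s₀} t → minIntervalLength c k ≤ s₀ → s₀ ≤ M → c ≤ t → t ≤ c + s₀ → t + s₀ ≡ s → Result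
  prepend t lo≤s₀ s₀≤M c≤t t≤c+s₀ t+s₀≡s
    with a , I ← subsetSumsInterval-exists k c≤1 lo≤s₀ s₀≤M =
    subst (λ s′ → Σ _ (SubsetSumsInterval c s′)) t+s₀≡s (t ∷ a , ∷-subsetSumsInterval c≤1 c≤t t≤c+s₀ I)
  split : Dec (s ≤ c + M) → Result
  split (yes s≤c+M) = prepend c (m+n≤o⇒m≤o∸n _ lo≤s) (m≤n+o⇒m∸n≤o s c s≤c+M)
    ≤-refl (m≤m+n c _) (m+[n∸m]≡n (m+n≤o⇒n≤o (minIntervalLength c k) lo≤s))
  split (no s≰c+M) = prepend (s ∸ M) (minIntervalLength≤maxIntervalLength c k) ≤-refl
    (m+n≤o⇒m≤o∸n c c+M≤s) (m≤n+o⇒m∸n≤o s M s≤hi) (m∸n+n≡m (m+n≤o⇒n≤o c c+M≤s))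
    where c+M≤s = <⇒≤ (≰⇒> s≰c+M)

minIntervalLength-0 : ∀ k → minIntervalLength 0 k ≡ 1
minIntervalLength-0 zero = refl
minIntervalLength-0 (suc k) = trans (+-identityʳ _) (minIntervalLength-0 k)

minIntervalLength-1 : ∀ k → minIntervalLength 1 k ≡ suc k
minIntervalLength-1 zero = refl
minIntervalLength-1 (suc k) = trans (+-comm _ 1) (cong suc (minIntervalLength-1 k))

suc≤maxIntervalLength-0 : ∀ k → suc k ≤ maxIntervalLength 0 k
suc≤maxIntervalLength-0 zero = ≤-refl
suc≤maxIntervalLength-0 (suc k) =
  ≤-trans (+-monoˡ-≤ (suc k) (≤-trans (s≤s z≤n) ih)) (+-monoʳ-≤ (maxIntervalLength 0 k) ih)
  where ih = suc≤maxIntervalLength-0 k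

suc-maxIntervalLength-1 : ∀ k → suc (maxIntervalLength 1 k) ≡ 2 ^ suc k
suc-maxIntervalLength-1 zero = refl
suc-maxIntervalLength-1 (suc k) = begin
  suc M + suc M         ≡⟨ cong (λ x → x + x) (suc-maxIntervalLength-1 k) ⟩
  2 ^ suc k + 2 ^ suc k ≡⟨ cong (2 ^ suc k +_) (+-identityʳ (2 ^ suc k)) ⟨
  2 ^ suc (suc k)       ∎
  where
  open ≡-Reasoning
  M = maxIntervalLength 1 k

intervalCode : (a : Vec ℕ (suc k)) → Vec (Vec Bool (pow₂ (suc k) + sum a)) (suc k)
intervalCode {k} a = zipWith _++_ (allColumns (suc k)) (blockDiagonal a)

intervalCode-linearlyIndependent : (a : Vec ℕ (suc k)) → LinearlyIndependent (intervalCode a)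
intervalCode-linearlyIndependent {k} a =
  zipWith-++-linearlyIndependent (allColumns (suc k)) (blockDiagonal a) (allColumns-linearlyIndependent k)

weight-intervalCode : (a : Vec ℕ (suc k)) (u : Vec Bool (suc k)) → u ≢ zeroVec (suc k) →
  weight (combination u (intervalCode a)) ≡ pow₂ k + subsetSum a u
weight-intervalCode {k} a u u≢0 = begin
  weight (combination u (intervalCode a))
    ≡⟨ cong weight (combination-zipWith-++ u _ _) ⟩
  weight (combination u (allColumns (suc k)) ++ combination u (blockDiagonal a))
    ≡⟨ weight-++ (combination u (allColumns (suc k))) _ ⟩
  weight (combination u (allColumns (suc k))) + weight (combination u (blockDiagonal a))
    ≡⟨ cong₂ _+_ (weight-allColumns k u u≢0) (weight-blockDiagonal a u) ⟩
  pow₂ k + subsetSum a u ∎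
  where open ≡-Reasoning

intervalCode-hasExactlyWeights : ∀ {c s} (a : Vec ℕ (suc k)) → SubsetSumsInterval c s a →
  HasExactlyWeights (intervalCode a) s
intervalCode-hasExactlyWeights {k} {c} {s} a (bounds , covers) =
  mapᴸ weightAt (upTo s) ,
  map⁺ (λ eq → +-cancelˡ-≡ c _ _ (+-cancelˡ-≡ (pow₂ k) _ _ eq)) (upTo⁺ s) ,
  trans (length-map weightAt (upTo s)) (length-upTo s) ,
  λ w → mk⇔ (listed⇒weight w) (weight⇒listed w)
  where
  weightAt : ℕ → ℕ
  weightAt j = pow₂ k + (c + j)
  listed⇒weight : ∀ w → w ∈ mapᴸ weightAt (upTo s) → IsNonzeroWeight (intervalCode a) w
  listed⇒weight w w∈ with j , j∈ , w≡ ← ∈-map⁻ weightAt w∈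
                    with u , u≢0 , σ≡c+j ← covers j (∈-upTo⁻ j∈) =
    combination u (intervalCode a) , (u , refl) , u≢0 ∘ intervalCode-linearlyIndependent a u ,
    trans (weight-intervalCode a u u≢0) (trans (cong (pow₂ k +_) σ≡c+j) (sym w≡))
  weight⇒listed : ∀ w → IsNonzeroWeight (intervalCode a) w → w ∈ mapᴸ weightAt (upTo s)
  weight⇒listed w (_ , (u , refl) , uG≢0 , weight≡w) =
    subst (_∈ mapᴸ weightAt (upTo s)) weightAt-j≡w (∈-map⁺ weightAt (∈-upTo⁺ j<s))
    where
    u≢0 : u ≢ zeroVec (suc k)
    u≢0 refl = uG≢0 (combination-zeroVec (intervalCode a))
    σ = subsetSum a u
    j = σ ∸ c
    c+j≡σ : c + j ≡ σ
    c+j≡σ = m+[n∸m]≡n (proj₁ (bounds u u≢0))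
    j<s : j < s
    j<s = +-cancelˡ-< c _ _ (subst (_< c + s) (sym c+j≡σ) (proj₂ (bounds u u≢0)))
    weightAt-j≡w : weightAt j ≡ w
    weightAt-j≡w = trans (cong (pow₂ k +_) c+j≡σ) (trans (sym (weight-intervalCode a u u≢0)) weight≡w)

code-from-subsetSumsInterval : ∀ {c s} → Σ (Vec ℕ (suc k)) (SubsetSumsInterval c s) →
  Σ ℕ λ n → Σ (Vec (Vec Bool n) (suc k)) λ G → LinearlyIndependent G × HasExactlyWeights G s
code-from-subsetSumsInterval (a , I) =
  _ , intervalCode a , intervalCode-linearlyIndependent a , intervalCode-hasExactlyWeights a I

corollary1 : (k s : ℕ) → 1 ≤ k → 1 ≤ s → s ≤ 2 ^ k ∸ 1 →
    Σ ℕ λ n → Σ (Vec (Vec Bool n) k) λ G →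
    LinearlyIndependent G × HasExactlyWeights G s
corollary1 (suc k) s _ 1≤s s≤2^k∸1 with s ≤? maxIntervalLength 0 k
... | yes s≤M₀ = code-from-subsetSumsInterval (subsetSumsInterval-exists k z≤n lo≤s s≤M₀)
  where lo≤s = subst (_≤ s) (sym (minIntervalLength-0 k)) 1≤s
... | no s≰M₀ = code-from-subsetSumsInterval (subsetSumsInterval-exists k ≤-refl lo≤s s≤M₁)
  where
  lo≤s = subst (_≤ s) (sym (minIntervalLength-1 k)) (≤-trans (suc≤maxIntervalLength-0 k) (<⇒≤ (≰⇒> s≰M₀)))
  s≤M₁ = subst (s ≤_) (cong (_∸ 1) (sym (suc-maxIntervalLength-1 k))) s≤2^k∸1
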